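{- Let $i_1, i_2 \in \mathbb{Q}$ with $0 \le i_1 \le i_2$, let $\kappa,\lambda\in\mathbb{Q}$ be positive, and let $A$ be any MTL formula. Then $$\boxminus_{[i_1,i_2]} A \;\equiv\; \Big(\Diamond^{ - }_{[\frac{3i_1-i_2}{2},\, i_1]}\big(A\,\mathcal{S}_{[i_2-i_1,\, i_2-i_1+\lambda]}\,\top\big)\Big)\;\land\;\Big(\Diamond^{ - }_{[i_2,\, \frac{3i_2-i_1}{2}]}\big(A\,\mathcal{U}_{[i_2-i_1,\, i_2-i_1+\kappa]}\,\top\big)\Big).$$
   Context: Metric Temporal Logic (MTL) over the rational timeline. Fix a set $\mathcal{P}$ of predicate symbols. A model is $M=(\mathbb{Q},<,V)$ where $V$ maps each time point $t\in\mathbb{Q}$ to a subset $V(t)\subseteq\mathcal{P}$. Formulae are given by $A ::= p \mid \top \mid \neg A \mid A\land A \mid \boxplus_I A \mid \boxminus_I A \mid \Diamond^{+}_I A \mid \Diamond^{ - }_I A \mid A\,\mathcal{S}_I\, A \mid A\,\mathcal{U}_I\, A$, where $p\in\mathcal{P}$ and $I=[a,b]$ ($a\le b$) is a closed bounded interval with rational endpoints. Semantics at time $t\in\mathbb{Q}$: $M,t\models p$ iff $p\in V(t)$; $M,t\models\top$ always; $\neg$ and $\land$ as usual; $M,t\models \Diamond^{ - }_I A$ iff $M,t'\models A$ for some $t'$ with $t-t'\in I$; $M,t\models \Diamond^{+}_I A$ iff $M,t'\models A$ for some $t'$ with $t'-t\in I$; $M,t\models\boxminus_I A$ iff $M,t'\models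 A$ for all $t'$ with $t-t'\in I$; $M,t\models\boxplus_I A$ iff $M,t'\models A$ for all $t'$ with $t'-t\in I$; $M,t\models A_1\,\mathcal{S}_I\,A_2$ iff there is $t'$ with $t-t'\in I$, $M,t'\models A_2$, and $M,t''\models A_1$ for all $t''\in[t',t]$; $M,t\models A_1\,\mathcal{U}_I\,A_2$ iff there is $t'$ with $t'-t\in I$, $M,t'\models A_2$, and $M,t''\models A_1$ for all $t''\in[t,t']$ (all time points range over $\mathbb{Q}$). Two formulae $A_1,A_2$ are equivalent, $A_1\equiv A_2$, iff for every model $M$ and every $t\in\mathbb{Q}$, $M,t\models A_1$ if and only if $M,t\models A_2$. -}

module Defs where

open import Data.Rational using (ℚ; _≤_; _<_; _+_; _-_; _*_; 0ℚ)
open import Data.Product using (Σ; _×_; ∃)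
open import Data.Unit using (⊤)
open import Data.Empty using (⊥)
open import Level using (0ℓ)

-- Closed bounded interval [a,b] with rational endpoints (well-formedness a ≤ b
-- is imposed separately by the predicate WF below).
record Interval : Set where
  constructor [_,_]
  field
    lo hi : ℚ
open Interval public

_∈I_ : ℚ → Interval → Set
x ∈I I = lo I ≤ x × x ≤ hi I

data Formula (P : Set) : Set where
  atom : P → Formula P
  top  : Formula P
  ¬ᶠ_  : Formula P → Formula P
  _∧ᶠ_ : Formula P → Formula P → Formula P
  ⊞    : Interval → Formula P → Formula P
  ⊟    : Interval → Formula P → Formula P
  ◇⁺   : Interval → Formula P → Formula P
  ◇⁻   : Interval → Formula P → Formula P
  _S⟨_⟩_ : Formula P → Interval → Formula P → Formula P
  _U⟨_⟩_ : Formula P → Interval → Formula P → Formula P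

WFI : Interval → Set
WFI I = lo I ≤ hi I

WF : {P : Set} → Formula P → Set
WF (atom p)     = ⊤
WF top          = ⊤
WF (¬ᶠ A)       = WF A
WF (A ∧ᶠ B)     = WF A × WF B
WF (⊞ I A)      = WFI I × WF A
WF (⊟ I A)      = WFI I × WF A
WF (◇⁺ I A)     = WFI I × WF A
WF (◇⁻ I A)     = WFI I × WF A
WF (A S⟨ I ⟩ B) = WF A × WFI I × WF B
WF (A U⟨ I ⟩ B) = WF A × WFI I × WF B

Model : Set → Set₁
Model P = ℚ → P → Set

_⊨_at_ : {P : Set} → Model P → Formula P → ℚ → Set
M ⊨ atom p at t = M t p
M ⊨ top at t = ⊤
M ⊨ ¬ᶠ A at t = M ⊨ A at t → ⊥
M ⊨ A ∧ᶠ B at t = (M ⊨ A at t) × (M ⊨ B at t)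
M ⊨ ◇⁻ I A at t = Σ ℚ λ t′ → ((t - t′) ∈I I) × (M ⊨ A at t′)
M ⊨ ◇⁺ I A at t = Σ ℚ λ t′ → ((t′ - t) ∈I I) × (M ⊨ A at t′)
M ⊨ ⊟ I A at t = (t′ : ℚ) → (t - t′) ∈I I → M ⊨ A at t′
M ⊨ ⊞ I A at t = (t′ : ℚ) → (t′ - t) ∈I I → M ⊨ A at t′
M ⊨ A S⟨ I ⟩ B at t = Σ ℚ λ t′ → ((t - t′) ∈I I) × (M ⊨ B at t′)
                        × ((t″ : ℚ) → t′ ≤ t″ → t″ ≤ t → M ⊨ A at t″)
M ⊨ A U⟨ I ⟩ B at t = Σ ℚ λ t′ → ((t′ - t) ∈I I) × (M ⊨ B at t′)
                        × ((t″ : ℚ) → t ≤ t″ → t″ ≤ t′ → M ⊨ A at t″)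

record _⇔_ (X Y : Set) : Set where
  field
    to   : X → Y
    from : Y → X

_≡ᶠ_ : {P : Set} → Formula P → Formula P → Set₁
_≡ᶠ_ {P} A B = (M : Model P) (t : ℚ) → (M ⊨ A at t) ⇔ (M ⊨ B at t)

-- Both sides say that A holds throughout [t − i₂, t − i₁], a window of width
-- d = i₂ − i₁. The Since-conjunct provides A on a window of width d ending
-- at some t₁ ≥ t − i₁, the Until-conjunct A on a window of width d starting
-- at some t₃ ≤ t − i₂; the outer ◇⁻-ranges confine t₁ − t₃ to at most
-- ((3i₂ − i₁) − (3i₁ − i₂)) / 2 = 2d, so the two windows overlap and their
-- union covers [t₃, t₁] ⊇ [t − i₂, t − i₁].
module Submission where

open import Defs
open import Data.Rational using (ℚ; _≤_; _<_; _+_; _-_; _*_; 0ℚ; ½; _/_; -_)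
open import Data.Integer using (+_)
open import Data.Rational.Properties
  using (≤-refl; ≤-trans; ≤-total; <⇒≤; +-monoˡ-≤; +-monoʳ-≤; neg-antimono-≤;
         +-inverseʳ; +-identityʳ; *-monoˡ-≤-nonNeg; module ≤-Reasoning)
open import Data.Rational.Solver using (module +-*-Solver)
open import Data.Product using (_×_; _,_)
open import Data.Sum using (inj₁; inj₂)
open import Data.Unit using (tt)
open import Relation.Binary.PropositionalEquality using (_≡_; refl; sym; subst)

open +-*-Solver

private
  variable
    P : Set
    A B : Formula P
    I : Interval
    a b c p q r u v u′ v′ : ℚ

p-[p-q]≡q : ∀ p q → p - (p - q) ≡ q
p-[p-q]≡q = solve 2 (λ p q → p :- (p :- q) := q) refl

p+[q-p]≡q : ∀ p q → p + (q - p) ≡ q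
p+[q-p]≡q = solve 2 (λ p q → p :+ (q :- p) := q) refl

[p+q]-p≡q : ∀ p q → (p + q) - p ≡ q
[p+q]-p≡q = solve 2 (λ p q → (p :+ q) :- p := q) refl

p≤q⇒p-r≤q-r : ∀ r → p ≤ q → p - r ≤ q - r
p≤q⇒p-r≤q-r r = +-monoˡ-≤ (- r)

q≤r⇒p-r≤p-q : ∀ p → q ≤ r → p - r ≤ p - q
q≤r⇒p-r≤p-q p q≤r = +-monoʳ-≤ p (neg-antimono-≤ q≤r)

p≤q⇒0≤q-p : p ≤ q → 0ℚ ≤ q - p
p≤q⇒0≤q-p {p} {q} p≤q = subst (_≤ q - p) (+-inverseʳ p) (p≤q⇒p-r≤q-r p p≤q)

p≤p+q : ∀ p → 0ℚ ≤ q → p ≤ p + q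
p≤p+q {q} p 0≤q = subst (_≤ p + q) (+-identityʳ p) (+-monoʳ-≤ p 0≤q)

p-q≤p : ∀ p → 0ℚ ≤ q → p - q ≤ p
p-q≤p {q} p 0≤q = subst (p - q ≤_) (+-identityʳ p) (+-monoʳ-≤ p (neg-antimono-≤ 0≤q))

sub-window⇒bounds : ∀ t s → (t - s) ∈I [ a , b ] → t - b ≤ s × s ≤ t - a
sub-window⇒bounds t s (a≤t-s , t-s≤b) =
  subst (t - _ ≤_) (p-[p-q]≡q t s) (q≤r⇒p-r≤p-q t t-s≤b) ,
  subst (_≤ t - _) (p-[p-q]≡q t s) (q≤r⇒p-r≤p-q t a≤t-s)

bounds⇒sub-window : ∀ t s → t - b ≤ s → s ≤ t - a → (t - s) ∈I [ a , b ]
bounds⇒sub-window {b} {a} t s t-b≤s s≤t-a =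
  subst (_≤ t - s) (p-[p-q]≡q t a) (q≤r⇒p-r≤p-q t s≤t-a) ,
  subst (t - s ≤_) (p-[p-q]≡q t b) (q≤r⇒p-r≤p-q t t-b≤s)

record HoldsOn (M : Model P) (A : Formula P) (u v : ℚ) : Set where
  constructor holdsOn
  field
    holds : ∀ s → u ≤ s → s ≤ v → M ⊨ A at s
open HoldsOn

module Semantics {P : Set} (M : Model P) where

  holdsOn-mono : u ≤ u′ → v′ ≤ v → HoldsOn M A u v → HoldsOn M A u′ v′
  holdsOn-mono u≤u′ v′≤v H =
    holdsOn λ s u′≤s s≤v′ → holds H s (≤-trans u≤u′ u′≤s) (≤-trans s≤v′ v′≤v)

  holdsOn-join : u′ ≤ v → HoldsOn M A u v → HoldsOn M A u′ v′ → HoldsOn M A u v′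
  holdsOn-join {v = v} {A = A} {u = u} {v′ = v′} u′≤v H H′ = holdsOn joined
    where
    joined : ∀ s → u ≤ s → s ≤ v′ → M ⊨ A at s
    joined s u≤s s≤v′ with ≤-total s v
    ... | inj₁ s≤v = holds H s u≤s s≤v
    ... | inj₂ v≤s = holds H′ s (≤-trans u′≤v v≤s) s≤v′

  ⊟⇒holdsOn : ∀ t → M ⊨ ⊟ [ a , b ] A at t → HoldsOn M A (t - b) (t - a)
  ⊟⇒holdsOn t □A = holdsOn λ s t-b≤s s≤t-a → □A s (bounds⇒sub-window t s t-b≤s s≤t-a)

  holdsOn⇒⊟ : ∀ t → HoldsOn M A (t - b) (t - a) → M ⊨ ⊟ [ a , b ] A at t
  holdsOn⇒⊟ t H s t-s∈I =
    let (t-b≤s , s≤t-a) = sub-window⇒bounds t s t-s∈I in holds H s t-b≤s s≤t-a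

  ◇⁻-intro : ∀ t → c ∈I I → M ⊨ A at (t - c) → M ⊨ ◇⁻ I A at t
  ◇⁻-intro {c = c} t c∈I A-at = t - c , subst (_∈I _) (sym (p-[p-q]≡q t c)) c∈I , A-at

  S-intro : ∀ t → c ∈I I → M ⊨ B at (t - c) → HoldsOn M A (t - c) t → M ⊨ A S⟨ I ⟩ B at t
  S-intro {c = c} t c∈I B-at H =
    t - c , subst (_∈I _) (sym (p-[p-q]≡q t c)) c∈I , B-at , holds H

  U-intro : ∀ t → c ∈I I → M ⊨ B at (t + c) → HoldsOn M A t (t + c) → M ⊨ A U⟨ I ⟩ B at t
  U-intro {c = c} t c∈I B-at H =
    t + c , subst (_∈I _) (sym ([p+q]-p≡q t c)) c∈I , B-at , holds H

  S⇒holdsOn : ∀ t → M ⊨ A S⟨ I ⟩ B at t → HoldsOn M A (t - lo I) t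
  S⇒holdsOn {I = I} t (t′ , window , _ , H) =
    let (_ , t′≤t-lo) = sub-window⇒bounds {b = hi I} t t′ window in
    holdsOn-mono t′≤t-lo ≤-refl (holdsOn H)

  U⇒holdsOn : ∀ t → M ⊨ A U⟨ I ⟩ B at t → HoldsOn M A t (t + lo I)
  U⇒holdsOn {I = I} t (t′ , (lo≤t′-t , _) , _ , H) =
    holdsOn-mono ≤-refl t+lo≤t′ (holdsOn H)
    where
    t+lo≤t′ : t + lo I ≤ t′
    t+lo≤t′ = subst (t + lo I ≤_) (p+[q-p]≡q t t′) (+-monoʳ-≤ t lo≤t′-t)

module DiamondRanges (i₁ i₂ : ℚ) (i₁≤i₂ : i₁ ≤ i₂) where

  d h₁ h₂ : ℚ
  d  = i₂ - i₁
  h₁ = ½ * ((+ 3 / 1) * i₁ - i₂)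
  h₂ = ½ * ((+ 3 / 1) * i₂ - i₁)

  0≤½d : 0ℚ ≤ ½ * d
  0≤½d = *-monoˡ-≤-nonNeg ½ (p≤q⇒0≤q-p i₁≤i₂)

  h₁≤i₁ : h₁ ≤ i₁
  h₁≤i₁ = subst (_≤ i₁) h₁≡i₁-½d (p-q≤p i₁ 0≤½d)
    where
    h₁≡i₁-½d : i₁ - ½ * d ≡ h₁
    h₁≡i₁-½d = solve 2 (λ a b → a :- con ½ :* (b :- a) := con ½ :* (con (+ 3 / 1) :* a :- b))
                 refl i₁ i₂

  i₂≤h₂ : i₂ ≤ h₂
  i₂≤h₂ = subst (i₂ ≤_) h₂≡i₂+½d (p≤p+q i₂ 0≤½d)
    where
    h₂≡i₂+½d : i₂ + ½ * d ≡ h₂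
    h₂≡i₂+½d = solve 2 (λ a b → b :+ con ½ :* (b :- a) := con ½ :* (con (+ 3 / 1) :* b :- a))
                 refl i₁ i₂

  [t-i₁]-d≡t-i₂ : ∀ t → (t - i₁) - d ≡ t - i₂
  [t-i₁]-d≡t-i₂ t = solve 3 (λ t a b → (t :- a) :- (b :- a) := t :- b) refl t i₁ i₂

  [t-i₂]+d≡t-i₁ : ∀ t → (t - i₂) + d ≡ t - i₁
  [t-i₂]+d≡t-i₁ t = solve 3 (λ t a b → (t :- b) :+ (b :- a) := t :- a) refl t i₁ i₂

  -- h₂ − h₁ = 2d: the windows of width d placed by the two diamonds overlap.
  windows-overlap : ∀ t {t₁ t₃} → t₁ ≤ t - h₁ → t - h₂ ≤ t₃ → t₁ - d ≤ t₃ + d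
  windows-overlap t {t₁} {t₃} t₁≤t-h₁ t-h₂≤t₃ = begin
    t₁ - d        ≤⟨ p≤q⇒p-r≤q-r d t₁≤t-h₁ ⟩
    (t - h₁) - d  ≡⟨ solve 3 (λ t a b →
                       (t :- con ½ :* (con (+ 3 / 1) :* a :- b)) :- (b :- a)
                       := (t :- con ½ :* (con (+ 3 / 1) :* b :- a)) :+ (b :- a)) refl t i₁ i₂ ⟩
    (t - h₂) + d  ≤⟨ +-monoˡ-≤ d t-h₂≤t₃ ⟩
    t₃ + d        ∎
    where open ≤-Reasoning

theorem4 : {P : Set} (i₁ i₂ κ λ′ : ℚ) → 0ℚ ≤ i₁ → i₁ ≤ i₂ → 0ℚ < κ → 0ℚ < λ′
    → (A : Formula P) → WF A
    → ⊟ [ i₁ , i₂ ] A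
    ≡ᶠ (◇⁻ [ ½ * ((+ 3 / 1) * i₁ - i₂) , i₁ ] (A S⟨ [ i₂ - i₁ , i₂ - i₁ + λ′ ] ⟩ top)
    ∧ᶠ ◇⁻ [ i₂ , ½ * ((+ 3 / 1) * i₂ - i₁) ] (A U⟨ [ i₂ - i₁ , i₂ - i₁ + κ ] ⟩ top))
theorem4 i₁ i₂ κ λ′ _ i₁≤i₂ 0<κ 0<λ′ A _ M t = record { to = to ; from = from }
  where
  open DiamondRanges i₁ i₂ i₁≤i₂
  open Semantics M

  Since Until Rhs : Formula _
  Since = A S⟨ [ d , d + λ′ ] ⟩ top
  Until = A U⟨ [ d , d + κ ] ⟩ top
  Rhs   = ◇⁻ [ h₁ , i₁ ] Since ∧ᶠ ◇⁻ [ i₂ , h₂ ] Until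

  to : M ⊨ ⊟ [ i₁ , i₂ ] A at t → M ⊨ Rhs at t
  to □A =
    ◇⁻-intro {A = Since} t (h₁≤i₁ , ≤-refl)
      (S-intro {B = top} (t - i₁) (≤-refl , p≤p+q d (<⇒≤ 0<λ′)) tt
        (subst (λ u → HoldsOn M A u (t - i₁)) (sym ([t-i₁]-d≡t-i₂ t)) H)) ,
    ◇⁻-intro {A = Until} t (≤-refl , i₂≤h₂)
      (U-intro {B = top} (t - i₂) (≤-refl , p≤p+q d (<⇒≤ 0<κ)) tt
        (subst (HoldsOn M A (t - i₂)) (sym ([t-i₂]+d≡t-i₁ t)) H))
    where
    H : HoldsOn M A (t - i₂) (t - i₁)
    H = ⊟⇒holdsOn t □A

  from : M ⊨ Rhs at t → M ⊨ ⊟ [ i₁ , i₂ ] A at t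
  from ((t₁ , t-t₁∈I , S₁) , (t₃ , t-t₃∈I , U₃)) =
    let (t-i₁≤t₁ , t₁≤t-h₁) = sub-window⇒bounds t t₁ t-t₁∈I
        (t-h₂≤t₃ , t₃≤t-i₂) = sub-window⇒bounds t t₃ t-t₃∈I
    in holdsOn⇒⊟ {A = A} t (holdsOn-mono t₃≤t-i₂ t-i₁≤t₁
         (holdsOn-join (windows-overlap t t₁≤t-h₁ t-h₂≤t₃)
           (U⇒holdsOn {B = top} t₃ U₃) (S⇒holdsOn {B = top} t₁ S₁)))
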